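{- Let $1\le m<k<n$ and let $K_{m,n}$ be the complete bipartite graph with parts of sizes $m$ and $n$. Then $\Delta^t_k(K_{m,n})$ is shellable and contractible.
   Context: For $k\ge 1$, $\Delta_k^t(G)$ is the simplicial complex on $V(G)$ whose facets are the complements $V(G)\setminus S$ of independent sets $S$ of size $k$ in $G$. -}

module Defs where

open import Data.Nat using (ℕ; suc; _+_; _<_; _≤_)
open import Data.Fin using (Fin; toℕ) renaming (_<_ to _<ᶠ_)
open import Data.Fin.Subset using (Subset; _∈_; _⊆_; ∁; _∩_; ∣_∣; ⁅_⁆) renaming (⊥ to ∅)
open import Data.Vec using (_++_; replicate)
open import Data.List using (List; length; lookup)
open import Data.List.Relation.Unary.Unique.Propositional using (Unique)
import Data.List.Membership.Propositional as LM
open import Data.Bool using (false)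
open import Data.Product using (Σ; Σ-syntax; _×_)
open import Data.Sum using (_⊎_)
open import Relation.Nullary using (¬_)
open import Relation.Binary.PropositionalEquality using (_≡_; _≢_)
open import Relation.Binary.Construct.Closure.ReflexiveTransitive using (Star)
open import Function.Bundles using (_⇔_)

Graph : ℕ → Set₁
Graph N = Fin N → Fin N → Set

Kmn : (m n : ℕ) → Graph (m + n)
Kmn m n x y = (toℕ x < m × m ≤ toℕ y) ⊎ (m ≤ toℕ x × toℕ y < m)

Independent : {N : ℕ} → Graph N → Subset N → Set
Independent G S = ∀ x y → x ∈ S → y ∈ S → ¬ G x y

Complex : ℕ → Set₁
Complex N = Subset N → Set

IsComplex : {N : ℕ} → Complex N → Set
IsComplex K = ∀ F G → G ⊆ F → K F → K G

Δt : {N : ℕ} → ℕ → Graph N → Complex N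
Δt {N} k G F = Σ[ S ∈ Subset N ] (Independent G S × ∣ S ∣ ≡ k × F ⊆ ∁ S)

IsFacet : {N : ℕ} → Complex N → Subset N → Set
IsFacet K F = K F × (∀ G → K G → F ⊆ G → G ≡ F)

-- A shelling: a duplicate-free list of exactly the facets F_0, F_1, ... such that
-- for each j, ⟨F_j⟩ ∩ ⟨F_0,...,F_{j-1}⟩ is pure of dimension dim F_j - 1,
-- i.e. every face F_i ∩ F_j (i < j) of it lies in a face H ⊆ F_j ∩ F_l (l < j)
-- with |H| = |F_j| - 1.
Shelling : {N : ℕ} → Complex N → List (Subset N) → Set
Shelling {N} K Fs =
  Unique Fs ×
  (∀ F → (F LM.∈ Fs) ⇔ IsFacet K F) ×
  (∀ (j i : Fin (length Fs)) → i <ᶠ j →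
     Σ[ l ∈ Fin (length Fs) ] (l <ᶠ j × Σ[ H ∈ Subset N ]
       (H ⊆ lookup Fs j × H ⊆ lookup Fs l ×
        (lookup Fs i ∩ lookup Fs j) ⊆ H × suc ∣ H ∣ ≡ ∣ lookup Fs j ∣)))

Shellable : {N : ℕ} → Complex N → Set
Shellable {N} K = Σ[ Fs ∈ List (Subset N) ] Shelling K Fs

ElemCollapse : {N : ℕ} → Complex N → Complex N → Set
ElemCollapse {N} K K' =
  IsComplex K ×
  Σ[ σ ∈ Subset N ] Σ[ τ ∈ Subset N ]
    (K τ × σ ⊆ τ × ∣ τ ∣ ≡ suc ∣ σ ∣ ×
     (∀ G → K G → σ ⊆ G → G ≡ σ ⊎ G ≡ τ) ×
     (∀ F → K' F ⇔ (K F × F ≢ σ × F ≢ τ)))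

Step : {N : ℕ} → Complex N → Complex N → Set
Step K K' = ElemCollapse K K' ⊎ ElemCollapse K' K

IsPoint : {N : ℕ} → Complex N → Set
IsPoint {N} K = Σ[ v ∈ Fin N ] (∀ F → K F ⇔ (F ≡ ∅ ⊎ F ≡ ⁅ v ⁆))

liftC : {N : ℕ} (p : ℕ) → Complex N → Complex (N + p)
liftC {N} p K F = Σ[ F₀ ∈ Subset N ] (K F₀ × F ≡ F₀ ++ replicate p false)

-- Contractible: simple-homotopy equivalent to a point (sequence of elementary
-- collapses/expansions, allowing finitely many extra vertices).
-- For finite simplicial complexes this is equivalent to contractibility of the
-- geometric realization, since Wh(1) = 0.
Contractible : {N : ℕ} → Complex N → Set₁
Contractible {N} K =
  Σ[ p ∈ ℕ ] Σ[ K' ∈ Complex (N + p) ] (Star Step (liftC p K) K' × IsPoint K')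

{-# OPTIONS --safe #-}
-- An independent set of K_{m,n} lies in one side, so for k > m the independent k-sets are the
-- k-subsets of the n-side. The facets of Δ = Δt k (Kmn m n) are therefore exactly A ∪ T with A the
-- m-side and T an (n − k)-subset of the n-side: Δ is the join of the full simplex on A with the
-- (n − k − 1)-skeleton of the simplex on the n-side.
--
-- Shellable: the lexicographic order of the (n − k)-subsets shells the skeleton, and prefixing every
-- facet with A preserves the shelling condition.
--
-- Contractible: every facet contains the first vertex a of A, so Δ is a cone with apex a. A cone
-- collapses onto its apex: if σ is a maximal nonempty face avoiding a, its only proper coface is
-- σ ∪ {a}, and removing the pair leaves a smaller cone.

module Submission where

open import Defs
open import Data.Nat using (ℕ; zero; suc; _+_; _∸_; _≤_; _<_; z≤n; s≤s; _≤?_; _<?_)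
open import Data.Nat.Properties
  using (≤-reflexive; <⇒≤; <⇒≢; <⇒≱; ≤⇒≯; +-identityʳ; m≤m+n; m∸[m∸n]≡n; suc-injective;
         module ≤-Reasoning)
  renaming (_≟_ to _≟ℕ_)
open import Data.Nat.Induction using (<-wellFounded)
open import Data.Bool.Properties using () renaming (_≟_ to _≟𝔹_)
open import Data.Fin using (Fin; zero; suc; toℕ; _↑ˡ_; _↑ʳ_) renaming (_<_ to _<ᶠ_; _≟_ to _≟ᶠ_)
open import Data.Fin.Properties using (toℕ-↑ˡ; toℕ-↑ʳ; toℕ<n; all?; ¬∀⟶∃¬)
open import Data.Fin.Subset
  using (Subset; inside; outside; _∈_; _∉_; _⊆_; _⊈_; _⊄_; _⊃_; ∁; _∩_; _∪_; ⁅_⁆; ∣_∣; ⊤; Nonempty; Empty)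
  renaming (⊥ to ∅)
open import Data.Fin.Subset.Properties
open import Data.Fin.Subset.Induction using (⊃-wellFounded)
open import Data.Vec using ([]; _∷_; _++_; splitAt; here; there)
open import Data.Vec.Properties using (≡-dec; map-++; map-replicate; zipWith-++; ++-injective; ∷-injectiveʳ; ++-injectiveʳ;
                                       lookup⇒[]=; []=⇒lookup; lookup-++ˡ; lookup-++ʳ)
open import Data.List using (List; []; _∷_; [_]; length; lookup; take; map; filter; reverse; _ʳ++_)
  renaming (_++_ to _++ₗ_)
open import Data.List.Properties using (filter-idem; filter-notAll)
open import Data.List.Membership.Propositional using () renaming (_∈_ to _∈ₗ_)
open import Data.List.Membership.Propositional.Properties using (∈-map⁺; ∈-map⁻; ∈-++⁺ˡ; ∈-++⁺ʳ; ∈-++⁻; ∈-filter⁺)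
open import Data.List.Relation.Unary.Any as Any using (here; there)
open import Data.List.Relation.Unary.Any.Properties using (reverse⁺; reverse⁻)
open import Data.List.Relation.Unary.Unique.Propositional using (Unique)
import Data.List.Relation.Unary.Unique.Propositional.Properties as Unique
import Data.List.Relation.Unary.AllPairs as AllPairs
import Data.List.Relation.Unary.All as All
open import Data.List.Relation.Binary.Sublist.Propositional using () renaming (⊆-refl to ⊑-refl)
import Data.List.Relation.Binary.Sublist.Propositional.Properties as Sublist
open import Data.Product using (Σ-syntax; ∃; ∃-syntax; _×_; _,_; proj₁; proj₂)
open import Data.Sum using (_⊎_; inj₁; inj₂; [_,_]′)
open import Data.Unit using (tt) renaming (⊤ to ⊤′)
open import Function using (id; _∘_)
open import Function.Bundles using (_⇔_; mk⇔; Equivalence)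
open import Induction.WellFounded using (Acc; acc)
open import Level using (Level)
open import Relation.Binary.Construct.Closure.ReflexiveTransitive using (Star; ε; _◅_)
open import Relation.Binary.PropositionalEquality using (_≡_; _≢_; refl; sym; trans; cong; subst; module ≡-Reasoning)
open import Relation.Nullary using (¬_; Dec; yes; no; ¬?; contradiction)
open import Relation.Nullary.Decidable using (_×-dec_; _⊎-dec_; _→-dec_; map′)
open import Relation.Unary using (Pred; Decidable)

private
  variable
    ℓ : Level
    m n N : ℕ

-- Subsets of Fin n

∣p++q∣≡∣p∣+∣q∣ : (p : Subset m) (q : Subset n) → ∣ p ++ q ∣ ≡ ∣ p ∣ + ∣ q ∣
∣p++q∣≡∣p∣+∣q∣ []            q = refl
∣p++q∣≡∣p∣+∣q∣ (inside ∷ p)  q = cong suc (∣p++q∣≡∣p∣+∣q∣ p q)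
∣p++q∣≡∣p∣+∣q∣ (outside ∷ p) q = ∣p++q∣≡∣p∣+∣q∣ p q

∣p∪⁅x⁆∣≡1+∣p∣ : (p : Subset n) {x : Fin n} → x ∉ p → ∣ p ∪ ⁅ x ⁆ ∣ ≡ suc ∣ p ∣
∣p∪⁅x⁆∣≡1+∣p∣ (inside ∷ p)  {zero}  x∉p = contradiction here x∉p
∣p∪⁅x⁆∣≡1+∣p∣ (outside ∷ p) {zero}  x∉p = cong (suc ∘ ∣_∣) (∪-identityʳ p)
∣p∪⁅x⁆∣≡1+∣p∣ (inside ∷ p)  {suc x} x∉p = cong suc (∣p∪⁅x⁆∣≡1+∣p∣ p (x∉p ∘ there))
∣p∪⁅x⁆∣≡1+∣p∣ (outside ∷ p) {suc x} x∉p = ∣p∪⁅x⁆∣≡1+∣p∣ p (x∉p ∘ there)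

x∈p⇒⁅x⁆⊆p : {p : Subset n} {x : Fin n} → x ∈ p → ⁅ x ⁆ ⊆ p
x∈p⇒⁅x⁆⊆p {x = x} x∈p y∈⁅x⁆ = subst (_∈ _) (sym (x∈⁅y⁆⇒x≡y x y∈⁅x⁆)) x∈p

∪-least : {p q s : Subset n} → p ⊆ s → q ⊆ s → p ∪ q ⊆ s
∪-least {p = p} {q} p⊆s q⊆s x∈p∪q = [ p⊆s , q⊆s ]′ (x∈p∪q⁻ p q x∈p∪q)

p⊆⁅x⁆⇒p≡∅⊎p≡⁅x⁆ : {p : Subset n} {x : Fin n} → p ⊆ ⁅ x ⁆ → p ≡ ∅ ⊎ p ≡ ⁅ x ⁆
p⊆⁅x⁆⇒p≡∅⊎p≡⁅x⁆ {p = p} {x} p⊆⁅x⁆ with x ∈? p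
... | yes x∈p = inj₂ (⊆-antisym p⊆⁅x⁆ (x∈p⇒⁅x⁆⊆p x∈p))
... | no  x∉p = inj₁ (⊆-antisym p⊆∅ ⊥⊆)
  where
  p⊆∅ : p ⊆ ∅
  p⊆∅ y∈p with refl ← x∈⁅y⁆⇒x≡y x (p⊆⁅x⁆ y∈p) = contradiction y∈p x∉p

x∉q∧q⊆p∪⁅x⁆⇒q⊆p : {p q : Subset n} {x : Fin n} → x ∉ q → q ⊆ p ∪ ⁅ x ⁆ → q ⊆ p
x∉q∧q⊆p∪⁅x⁆⇒q⊆p {p = p} {x = x} x∉q q⊆p∪⁅x⁆ y∈q with x∈p∪q⁻ p ⁅ x ⁆ (q⊆p∪⁅x⁆ y∈q)
... | inj₁ y∈p   = y∈p
... | inj₂ y∈⁅x⁆ with refl ← x∈⁅y⁆⇒x≡y x y∈⁅x⁆ = contradiction y∈q x∉q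

p⊆q∧p⊄q⇒q⊆p : {p q : Subset n} → p ⊆ q → p ⊄ q → q ⊆ p
p⊆q∧p⊄q⇒q⊆p {p = p} p⊆q p⊄q {x} x∈q with x ∈? p
... | yes x∈p = x∈p
... | no  x∉p = contradiction ((λ {y} → p⊆q {y}) , x , x∈q , x∉p) p⊄q

p⊆q∧∣q∣≤∣p∣⇒p≡q : {p q : Subset n} → p ⊆ q → ∣ q ∣ ≤ ∣ p ∣ → p ≡ q
p⊆q∧∣q∣≤∣p∣⇒p≡q p⊆q ∣q∣≤∣p∣ =
  ⊆-antisym p⊆q (p⊆q∧p⊄q⇒q⊆p p⊆q (λ p⊂q → <⇒≱ (p⊂q⇒∣p∣<∣q∣ p⊂q) ∣q∣≤∣p∣))

∣p∣<n⇒∃∉ : {p : Subset n} → ∣ p ∣ < n → ∃[ x ] x ∉ p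
∣p∣<n⇒∃∉ {n} {p} ∣p∣<n = ¬∀⟶∃¬ n (_∈ p) (_∈? p) λ all∈p →
  <⇒≢ ∣p∣<n (trans (cong ∣_∣ (⊆-antisym ⊆⊤ λ {x} _ → all∈p x)) (∣⊤∣≡n n))

∃-subsetOfSize : ∀ {r n} → r ≤ n → Σ[ s ∈ Subset n ] ∣ s ∣ ≡ r
∃-subsetOfSize {zero}  {n} _ = ∅ , ∣⊥∣≡0 n
∃-subsetOfSize {suc r} (s≤s r≤n) with s , ∣s∣ ← ∃-subsetOfSize r≤n = inside ∷ s , cong suc ∣s∣

∣∅++p∣≡∣p∣ : ∀ m (p : Subset n) → ∣ ∅ {m} ++ p ∣ ≡ ∣ p ∣
∣∅++p∣≡∣p∣ m p = trans (∣p++q∣≡∣p∣+∣q∣ (∅ {m}) p) (cong (_+ ∣ p ∣) (∣⊥∣≡0 m))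

∁[∅++p]≡⊤++∁p : ∀ m (p : Subset n) → ∁ (∅ {m} ++ p) ≡ ⊤ ++ ∁ p
∁[∅++p]≡⊤++∁p m p = trans (map-++ _ ∅ p) (cong (_++ ∁ p) (map-replicate _ outside m))

∅++∅≡∅ : ∀ m n → ∅ {m} ++ ∅ {n} ≡ ∅
∅++∅≡∅ zero    n = refl
∅++∅≡∅ (suc m) n = cong (outside ∷_) (∅++∅≡∅ m n)

∁-involutive : (p : Subset n) → ∁ (∁ p) ≡ p
∁-involutive []            = refl
∁-involutive (inside ∷ p)  = cong (inside ∷_) (∁-involutive p)
∁-involutive (outside ∷ p) = cong (outside ∷_) (∁-involutive p)

⊆-++⁻ : (p p′ : Subset m) {q q′ : Subset n} → p ++ q ⊆ p′ ++ q′ → p ⊆ p′ × q ⊆ q′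
⊆-++⁻ []      []        pq⊆ = (λ ()) , pq⊆
⊆-++⁻ (s ∷ p) (s′ ∷ p′) pq⊆ with p⊆p′ , q⊆q′ ← ⊆-++⁻ p p′ (drop-∷-⊆ pq⊆) = head⊆ , q⊆q′
  where
  head⊆ : s ∷ p ⊆ s′ ∷ p′
  head⊆ here with here ← pq⊆ here = here
  head⊆ (there x∈p) = there (p⊆p′ x∈p)

x∈p⇒x↑ˡ∈p++q : {p : Subset m} (q : Subset n) {x : Fin m} → x ∈ p → x ↑ˡ n ∈ p ++ q
x∈p⇒x↑ˡ∈p++q {p = p} q {x} x∈p = lookup⇒[]= (x ↑ˡ _) (p ++ q) (trans (lookup-++ˡ p q x) ([]=⇒lookup x∈p))

x∈q⇒m↑ʳx∈p++q : (p : Subset m) {q : Subset n} {x : Fin n} → x ∈ q → m ↑ʳ x ∈ p ++ q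
x∈q⇒m↑ʳx∈p++q {m} p {q} {x} x∈q = lookup⇒[]= (m ↑ʳ x) (p ++ q) (trans (lookup-++ʳ p q x) ([]=⇒lookup x∈q))

∈∅++⇒m≤ : ∀ m {s : Subset n} {x} → x ∈ ∅ {m} ++ s → m ≤ toℕ x
∈∅++⇒m≤ zero    _                      = z≤n
∈∅++⇒m≤ (suc m) {x = suc x} (there x∈) = s≤s (∈∅++⇒m≤ m x∈)

⁅x↑ˡ⁆≡⁅x⁆++∅ : (x : Fin m) → ⁅ x ↑ˡ n ⁆ ≡ ⁅ x ⁆ ++ ∅
⁅x↑ˡ⁆≡⁅x⁆++∅ {suc m} {n} zero = cong (inside ∷_) (sym (∅++∅≡∅ m n))
⁅x↑ˡ⁆≡⁅x⁆++∅ (suc x) = cong (outside ∷_) (⁅x↑ˡ⁆≡⁅x⁆++∅ x)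

-- Shelling orders

ShellingStep : Subset N → Subset N → Subset N → Set
ShellingStep {N} F G G′ = Σ[ H ∈ Subset N ] (H ⊆ F × H ⊆ G′ × G ∩ F ⊆ H × suc ∣ H ∣ ≡ ∣ F ∣)

ShellsOnto : List (Subset N) → Subset N → Set
ShellsOnto earlier F = ∀ {G} → G ∈ₗ earlier → ∃[ G′ ] (G′ ∈ₗ earlier × ShellingStep F G G′)

-- The first argument lists the facets placed so far, most recent first.
ShellingOrder : List (Subset N) → List (Subset N) → Set
ShellingOrder earlier []       = ⊤′
ShellingOrder earlier (F ∷ Fs) = ShellsOnto earlier F × ShellingOrder (F ∷ earlier) Fs

ShellingCondition : List (Subset N) → Set
ShellingCondition {N} Fs =
  ∀ (j i : Fin (length Fs)) → i <ᶠ j →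
    Σ[ l ∈ Fin (length Fs) ] (l <ᶠ j × ShellingStep (lookup Fs j) (lookup Fs i) (lookup Fs l))

∷-shellingStep : ∀ b {F G G′ : Subset N} → ShellingStep F G G′ → ShellingStep (b ∷ F) (b ∷ G) (b ∷ G′)
∷-shellingStep inside  (H , H⊆F , H⊆G′ , G∩F⊆H , ∣H∣) = inside ∷ H , s⊆s H⊆F , s⊆s H⊆G′ , in⊆in G∩F⊆H , cong suc ∣H∣
∷-shellingStep outside (H , H⊆F , H⊆G′ , G∩F⊆H , ∣H∣) = outside ∷ H , s⊆s H⊆F , s⊆s H⊆G′ , out⊆ G∩F⊆H , ∣H∣

++-shellingStep : (p : Subset m) {F G G′ : Subset N} → ShellingStep F G G′ → ShellingStep (p ++ F) (p ++ G) (p ++ G′)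
++-shellingStep []      step = step
++-shellingStep (b ∷ p) step = ∷-shellingStep b (++-shellingStep p step)

shellingOrder-++ : {earlier Xs Ys : List (Subset N)} →
                   ShellingOrder earlier Xs → ShellingOrder (Xs ʳ++ earlier) Ys → ShellingOrder earlier (Xs ++ₗ Ys)
shellingOrder-++ {Xs = []}     _                Ys-order = Ys-order
shellingOrder-++ {Xs = X ∷ Xs} (X-step , order) Ys-order = X-step , shellingOrder-++ order Ys-order

shellingOrder-map : (f : Subset N → Subset m) → (∀ {F G G′} → ShellingStep F G G′ → ShellingStep (f F) (f G) (f G′)) →
                    {earlier Ys : List (Subset N)} {before : List (Subset m)} →
                    ShellingOrder earlier Ys → (∀ {T} → T ∈ₗ Ys → ShellsOnto before (f T)) →
                    ShellingOrder (map f earlier ++ₗ before) (map f Ys)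
shellingOrder-map f f-step {Ys = []}     _                 _      = tt
shellingOrder-map f f-step {earlier} {Y ∷ Ys} {before} (Y-step , order) across =
  fY-step , shellingOrder-map f f-step order (across ∘ there)
  where
  fY-step : ShellsOnto (map f earlier ++ₗ before) (f Y)
  fY-step G∈ with ∈-++⁻ (map f earlier) G∈
  ... | inj₂ G∈before with G′ , G′∈ , step ← across (here refl) G∈before = G′ , ∈-++⁺ʳ (map f earlier) G′∈ , step
  ... | inj₁ G∈fearlier with G₀ , G₀∈ , refl ← ∈-map⁻ f G∈fearlier with G₀′ , G₀′∈ , step ← Y-step G₀∈ =
    f G₀′ , ∈-++⁺ˡ (∈-map⁺ f G₀′∈) , f-step step

lookup-shellsOnto : {earlier Fs : List (Subset N)} → ShellingOrder earlier Fs →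
                    (j : Fin (length Fs)) → ShellsOnto (take (toℕ j) Fs ʳ++ earlier) (lookup Fs j)
lookup-shellsOnto {Fs = _ ∷ _} (F-step , _)     zero    = F-step
lookup-shellsOnto {Fs = _ ∷ _} (_      , order) (suc j) = lookup-shellsOnto order j

lookup∈take : {A : Set} (xs : List A) {j i : Fin (length xs)} → i <ᶠ j → lookup xs i ∈ₗ take (toℕ j) xs
lookup∈take (x ∷ xs) {suc j} {zero}  _         = here refl
lookup∈take (x ∷ xs) {suc j} {suc i} (s≤s i<j) = there (lookup∈take xs i<j)

∈take⇒lookup : {A : Set} (xs : List A) (j : Fin (length xs)) {y : A} →
               y ∈ₗ take (toℕ j) xs → ∃[ l ] (l <ᶠ j × lookup xs l ≡ y)
∈take⇒lookup (x ∷ xs) (suc j) (here refl) = zero , s≤s z≤n , refl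
∈take⇒lookup (x ∷ xs) (suc j) (there y∈)  with l , l<j , refl ← ∈take⇒lookup xs j y∈ = suc l , s≤s l<j , refl

shellingOrder⇒shellingCondition : {Fs : List (Subset N)} → ShellingOrder [] Fs → ShellingCondition Fs
shellingOrder⇒shellingCondition {Fs = Fs} order j i i<j
  with G′ , G′∈ , step ← lookup-shellsOnto order j (reverse⁺ (lookup∈take Fs i<j))
  with l , l<j , refl ← ∈take⇒lookup Fs j (reverse⁻ G′∈)
  = l , l<j , step

subsetsOfSize : ∀ n → ℕ → List (Subset n)
subsetsOfSize zero    zero    = [ [] ]
subsetsOfSize zero    (suc r) = []
subsetsOfSize (suc n) zero    = map (outside ∷_) (subsetsOfSize n zero)
subsetsOfSize (suc n) (suc r) = map (outside ∷_) (subsetsOfSize n (suc r)) ++ₗ map (inside ∷_) (subsetsOfSize n r)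

∈-subsetsOfSize⁻ : ∀ n r {T : Subset n} → T ∈ₗ subsetsOfSize n r → ∣ T ∣ ≡ r
∈-subsetsOfSize⁻ zero    zero    (here refl) = refl
∈-subsetsOfSize⁻ (suc n) zero    T∈ with T₀ , T₀∈ , refl ← ∈-map⁻ (outside ∷_) T∈ = ∈-subsetsOfSize⁻ n zero T₀∈
∈-subsetsOfSize⁻ (suc n) (suc r) T∈ with ∈-++⁻ (map (outside ∷_) (subsetsOfSize n (suc r))) T∈
... | inj₁ T∈out with T₀ , T₀∈ , refl ← ∈-map⁻ (outside ∷_) T∈out = ∈-subsetsOfSize⁻ n (suc r) T₀∈
... | inj₂ T∈in  with T₀ , T₀∈ , refl ← ∈-map⁻ (inside ∷_) T∈in  = cong suc (∈-subsetsOfSize⁻ n r T₀∈)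

∈-subsetsOfSize⁺ : ∀ {n r} (T : Subset n) → ∣ T ∣ ≡ r → T ∈ₗ subsetsOfSize n r
∈-subsetsOfSize⁺ {zero}  {zero}  []            _    = here refl
∈-subsetsOfSize⁺ {suc n} {zero}  (outside ∷ T) ∣T∣ = ∈-map⁺ (outside ∷_) (∈-subsetsOfSize⁺ T ∣T∣)
∈-subsetsOfSize⁺ {suc n} {suc r} (outside ∷ T) ∣T∣ = ∈-++⁺ˡ (∈-map⁺ (outside ∷_) (∈-subsetsOfSize⁺ T ∣T∣))
∈-subsetsOfSize⁺ {suc n} {suc r} (inside ∷ T)  ∣T∣ =
  ∈-++⁺ʳ (map (outside ∷_) (subsetsOfSize n (suc r))) (∈-map⁺ (inside ∷_) (∈-subsetsOfSize⁺ T (suc-injective ∣T∣)))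

subsetsOfSize-unique : ∀ n r → Unique (subsetsOfSize n r)
subsetsOfSize-unique zero    zero    = All.[] AllPairs.∷ AllPairs.[]
subsetsOfSize-unique zero    (suc r) = AllPairs.[]
subsetsOfSize-unique (suc n) zero    = Unique.map⁺ ∷-injectiveʳ (subsetsOfSize-unique n zero)
subsetsOfSize-unique (suc n) (suc r) =
  Unique.++⁺ (Unique.map⁺ ∷-injectiveʳ (subsetsOfSize-unique n (suc r)))
             (Unique.map⁺ ∷-injectiveʳ (subsetsOfSize-unique n r))
             outside≢inside
  where
  outside≢inside : ∀ {T} → ¬ (T ∈ₗ map (outside ∷_) (subsetsOfSize n (suc r)) × T ∈ₗ map (inside ∷_) (subsetsOfSize n r))
  outside≢inside (T∈out , T∈in) with _ , _ , refl ← ∈-map⁻ (outside ∷_) T∈out with _ , _ , () ← ∈-map⁻ (inside ∷_) T∈in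

subsetsOfSize-shellingOrder : ∀ n r → ShellingOrder [] (subsetsOfSize n r)
subsetsOfSize-shellingOrder zero    zero    = (λ ()) , tt
subsetsOfSize-shellingOrder zero    (suc r) = tt
subsetsOfSize-shellingOrder (suc n) zero    =
  shellingOrder-map (outside ∷_) (∷-shellingStep outside) (subsetsOfSize-shellingOrder n zero) (λ _ ())
subsetsOfSize-shellingOrder (suc n) (suc r) =
  shellingOrder-++ (shellingOrder-map (outside ∷_) (∷-shellingStep outside) (subsetsOfSize-shellingOrder n (suc r)) (λ _ ()))
                   (shellingOrder-map (inside ∷_) (∷-shellingStep inside) (subsetsOfSize-shellingOrder n r) across)
  where
  Outs = map (outside ∷_) (subsetsOfSize n (suc r))

  ∣T∣<n : ∀ {T S} → T ∈ₗ subsetsOfSize n r → S ∈ₗ subsetsOfSize n (suc r) → ∣ T ∣ < n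
  ∣T∣<n {T} {S} T∈ S∈ = subst (_< n) (sym (∈-subsetsOfSize⁻ n r T∈)) (subst (_≤ n) (∈-subsetsOfSize⁻ n (suc r) S∈) (∣p∣≤n S))

  -- A new facet inside ∷ T meets an earlier outside ∷ S within outside ∷ T, which lies in the
  -- earlier facet outside ∷ (T ∪ ⁅ x ⁆) for any x ∉ T.
  across : ∀ {T} → T ∈ₗ subsetsOfSize n r → ShellsOnto (reverse Outs) (inside ∷ T)
  across {T} T∈ G∈
    with S , S∈ , refl ← ∈-map⁻ (outside ∷_) (reverse⁻ {xs = Outs} G∈)
    with x , x∉T ← ∣p∣<n⇒∃∉ (∣T∣<n T∈ S∈)
    = outside ∷ (T ∪ ⁅ x ⁆) ,
      reverse⁺ (∈-map⁺ (outside ∷_) (∈-subsetsOfSize⁺ _ ∣T∪⁅x⁆∣≡1+r)) ,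
      outside ∷ T , out⊆ ⊆-refl , s⊆s (p⊆p∪q ⁅ x ⁆) , s⊆s (p∩q⊆q S T) , refl
    where ∣T∪⁅x⁆∣≡1+r = trans (∣p∪⁅x⁆∣≡1+∣p∣ T x∉T) (cong suc (∈-subsetsOfSize⁻ n r T∈))

join-skeleton-shellable : ∀ {m n r} {K : Complex (m + n)} →
                          (∀ {F} → IsFacet K F ⇔ (∃[ T ] (∣ T ∣ ≡ r × F ≡ ⊤ {m} ++ T))) → Shellable K
join-skeleton-shellable {m} {n} {r} facet⇔ =
  map (⊤ ++_) (subsetsOfSize n r) ,
  Unique.map⁺ (++-injectiveʳ ⊤ ⊤) (subsetsOfSize-unique n r) ,
  (λ F → mk⇔ (Equivalence.from facet⇔ ∘ from-list) (to-list ∘ Equivalence.to facet⇔)) ,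
  shellingOrder⇒shellingCondition
    (shellingOrder-map (⊤ ++_) (++-shellingStep ⊤) (subsetsOfSize-shellingOrder n r) (λ _ ()))
  where
  from-list : ∀ {F} → F ∈ₗ map (⊤ ++_) (subsetsOfSize n r) → ∃[ T ] (∣ T ∣ ≡ r × F ≡ ⊤ ++ T)
  from-list F∈ with T , T∈ , refl ← ∈-map⁻ (⊤ ++_) F∈ = T , ∈-subsetsOfSize⁻ n r T∈ , refl
  to-list : ∀ {F} → ∃[ T ] (∣ T ∣ ≡ r × F ≡ ⊤ ++ T) → F ∈ₗ map (⊤ ++_) (subsetsOfSize n r)
  to-list (T , ∣T∣ , refl) = ∈-map⁺ (⊤ ++_) (∈-subsetsOfSize⁺ T ∣T∣)

-- Collapsing a cone onto its apex

record IsCone (a : Fin N) (K : Complex N) : Set where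
  field
    isComplex : IsComplex K
    ∪-apex    : ∀ {F} → K F → K (F ∪ ⁅ a ⁆)
    ∅-face    : K ∅

NonemptyBaseFace : Complex N → Fin N → Subset N → Set
NonemptyBaseFace K a F = K F × a ∉ F × Nonempty F

nonemptyBaseFace? : {K : Complex N} → Decidable K → ∀ a → Decidable (NonemptyBaseFace K a)
nonemptyBaseFace? K? a F = K? F ×-dec ¬? (a ∈? F) ×-dec nonempty? F

Maximal : Pred (Subset N) ℓ → Subset N → Set ℓ
Maximal P σ = P σ × (∀ {G} → P G → σ ⊆ G → G ⊆ σ)

∃-maximal : {P : Pred (Subset N) ℓ} → Decidable P → ∀ {σ} → P σ → ∃ (Maximal P)
∃-maximal {P = P} P? {σ} = go (⊃-wellFounded σ)
  where
  go : ∀ {σ} → Acc _⊃_ σ → P σ → ∃ (Maximal P)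
  go {σ} (acc larger) Pσ with anySubset? (λ G → (σ ⊂? G) ×-dec P? G)
  ... | yes (G , σ⊂G , PG) = go (larger σ⊂G) PG
  ... | no  ∄G            = σ , Pσ , λ PG σ⊆G → p⊆q∧p⊄q⇒q⊆p σ⊆G (λ σ⊂G → ∄G (_ , σ⊂G , PG))

removePair : Complex N → Subset N → Subset N → Complex N
removePair K σ τ F = K F × F ≢ σ × F ≢ τ

removePair? : {K : Complex N} → Decidable K → ∀ σ τ → Decidable (removePair K σ τ)
removePair? K? σ τ F = K? F ×-dec ¬? (≡-dec _≟𝔹_ F σ) ×-dec ¬? (≡-dec _≟𝔹_ F τ)

allSubsets : ∀ n → List (Subset n)
allSubsets zero    = [ [] ]
allSubsets (suc n) = map (inside ∷_) (allSubsets n) ++ₗ map (outside ∷_) (allSubsets n)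

∈-allSubsets : (p : Subset n) → p ∈ₗ allSubsets n
∈-allSubsets []                    = here refl
∈-allSubsets (inside ∷ p)          = ∈-++⁺ˡ (∈-map⁺ (inside ∷_) (∈-allSubsets p))
∈-allSubsets {suc n} (outside ∷ p) = ∈-++⁺ʳ (map (inside ∷_) (allSubsets n)) (∈-map⁺ (outside ∷_) (∈-allSubsets p))

faceCount : {K : Complex N} → Decidable K → ℕ
faceCount K? = length (filter K? (allSubsets _))

length-filter-< : {A : Set} {P Q : Pred A ℓ} (P? : Decidable P) (Q? : Decidable Q) → (∀ {x} → Q x → P x) →
                  ∀ {x xs} → x ∈ₗ xs → P x → ¬ Q x → length (filter Q? xs) < length (filter P? xs)
length-filter-< P? Q? Q⇒P {x} {xs} x∈xs Px ¬Qx = begin-strict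
  length (filter Q? xs)               ≡⟨ cong length (filter-idem Q? xs) ⟨
  length (filter Q? (filter Q? xs))   ≤⟨ Sublist.length-mono-≤ (Sublist.filter⁺ Q? Q? (λ { refl → id })
                                          (Sublist.filter⁺ Q? P? (λ { refl → Q⇒P }) (⊑-refl {x = xs}))) ⟩
  length (filter Q? (filter P? xs))   <⟨ filter-notAll Q? (filter P? xs) (Any.map (λ { refl → ¬Qx }) (∈-filter⁺ P? x∈xs Px)) ⟩
  length (filter P? xs)               ∎
  where open ≤-Reasoning

module _ {a : Fin N} {K : Complex N} (cone : IsCone a K) {σ : Subset N}
         (σ-max : Maximal (NonemptyBaseFace K a) σ) where

  open IsCone cone

  private
    Kσ : K σ
    Kσ = proj₁ (proj₁ σ-max)
    a∉σ : a ∉ σ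
    a∉σ = proj₁ (proj₂ (proj₁ σ-max))
    σ-nonempty : Nonempty σ
    σ-nonempty = proj₂ (proj₂ (proj₁ σ-max))

  -- For x ≢ a in a face G ⊇ σ, σ ∪ ⁅ x ⁆ is again a nonempty base face, so x ∈ σ by maximality.
  ⊇σ⇒⊆σ∪⁅a⁆ : ∀ {G} → K G → σ ⊆ G → G ⊆ σ ∪ ⁅ a ⁆
  ⊇σ⇒⊆σ∪⁅a⁆ {G} KG σ⊆G {x} x∈G with x ≟ᶠ a
  ... | yes refl = q⊆p∪q σ ⁅ a ⁆ (x∈⁅x⁆ a)
  ... | no  x≢a  = p⊆p∪q ⁅ a ⁆ (proj₂ σ-max σ∪⁅x⁆-base (p⊆p∪q ⁅ x ⁆) (q⊆p∪q σ ⁅ x ⁆ (x∈⁅x⁆ x)))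
    where
    σ∪⁅x⁆-base : NonemptyBaseFace K a (σ ∪ ⁅ x ⁆)
    σ∪⁅x⁆-base = isComplex G (σ ∪ ⁅ x ⁆) (∪-least σ⊆G (x∈p⇒⁅x⁆⊆p x∈G)) KG
               , [ a∉σ , (λ a∈⁅x⁆ → x≢a (sym (x∈⁅y⁆⇒x≡y x a∈⁅x⁆))) ]′ ∘ x∈p∪q⁻ σ ⁅ x ⁆
               , x , q⊆p∪q σ ⁅ x ⁆ (x∈⁅x⁆ x)

  maximal-base-face-free : ∀ G → K G → σ ⊆ G → G ≡ σ ⊎ G ≡ σ ∪ ⁅ a ⁆
  maximal-base-face-free G KG σ⊆G with a ∈? G
  ... | yes a∈G = inj₂ (⊆-antisym (⊇σ⇒⊆σ∪⁅a⁆ KG σ⊆G) (∪-least σ⊆G (x∈p⇒⁅x⁆⊆p a∈G)))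
  ... | no  a∉G = inj₁ (⊆-antisym (x∉q∧q⊆p∪⁅x⁆⇒q⊆p a∉G (⊇σ⇒⊆σ∪⁅a⁆ KG σ⊆G)) σ⊆G)

  maximal-base-face-collapse : ElemCollapse K (removePair K σ (σ ∪ ⁅ a ⁆))
  maximal-base-face-collapse =
    isComplex , σ , σ ∪ ⁅ a ⁆ , ∪-apex Kσ , p⊆p∪q ⁅ a ⁆ , ∣p∪⁅x⁆∣≡1+∣p∣ σ a∉σ , maximal-base-face-free ,
    λ F → mk⇔ id id

  private
    σ⊈remaining : ∀ {F} → removePair K σ (σ ∪ ⁅ a ⁆) F → σ ⊈ F
    σ⊈remaining (KF , F≢σ , F≢τ) σ⊆F = [ F≢σ , F≢τ ]′ (maximal-base-face-free _ KF σ⊆F)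

  removePair-isCone : IsCone a (removePair K σ (σ ∪ ⁅ a ⁆))
  removePair-isCone = record
    { isComplex = λ F F′ F′⊆F KF →
        isComplex F F′ F′⊆F (proj₁ KF) ,
        (λ { refl → σ⊈remaining KF F′⊆F }) ,
        (λ { refl → σ⊈remaining KF (F′⊆F ∘ p⊆p∪q ⁅ a ⁆) })
    ; ∪-apex = λ {F} KF →
        ∪-apex (proj₁ KF) ,
        (λ F∪⁅a⁆≡σ → a∉σ (subst (a ∈_) F∪⁅a⁆≡σ (q⊆p∪q F ⁅ a ⁆ (x∈⁅x⁆ a)))) ,
        (λ F∪⁅a⁆≡τ → σ⊈remaining KF (x∉q∧q⊆p∪⁅x⁆⇒q⊆p a∉σ (subst (σ ⊆_) (sym F∪⁅a⁆≡τ) (p⊆p∪q ⁅ a ⁆))))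
    ; ∅-face = ∅-face ,
        (λ ∅≡σ → let x , x∈σ = σ-nonempty in ∉⊥ (subst (x ∈_) (sym ∅≡σ) x∈σ)) ,
        (λ ∅≡τ → ∉⊥ (subst (a ∈_) (sym ∅≡τ) (q⊆p∪q σ ⁅ a ⁆ (x∈⁅x⁆ a))))
    }

  removePair-fewerFaces : (K? : Decidable K) → faceCount (removePair? K? σ (σ ∪ ⁅ a ⁆)) < faceCount K?
  removePair-fewerFaces K? = length-filter-< K? (removePair? K? σ (σ ∪ ⁅ a ⁆)) proj₁ (∈-allSubsets σ) Kσ
                               (λ (_ , σ≢σ , _) → σ≢σ refl)

cone-isPoint : {a : Fin N} {K : Complex N} → IsCone a K → (∀ F → ¬ NonemptyBaseFace K a F) → IsPoint K
cone-isPoint {a = a} {K} cone no-base = a , λ F → mk⇔ (p⊆⁅x⁆⇒p≡∅⊎p≡⁅x⁆ ∘ ⊆⁅a⁆) from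
  where
  open IsCone cone
  ⊆⁅a⁆ : ∀ {F} → K F → F ⊆ ⁅ a ⁆
  ⊆⁅a⁆ KF {x} x∈F with x ≟ᶠ a
  ... | yes refl = x∈⁅x⁆ a
  ... | no  x≢a  = contradiction (isComplex _ ⁅ x ⁆ (x∈p⇒⁅x⁆⊆p x∈F) KF , x≢y⇒x∉⁅y⁆ (x≢a ∘ sym) , x , x∈⁅x⁆ x)
                                 (no-base ⁅ x ⁆)
  from : ∀ {F} → F ≡ ∅ ⊎ F ≡ ⁅ a ⁆ → K F
  from (inj₁ refl) = ∅-face
  from (inj₂ refl) = subst K (∪-identityˡ ⁅ a ⁆) (∪-apex ∅-face)

CollapsesToPoint : Complex N → Set₁
CollapsesToPoint {N} K = Σ[ K′ ∈ Complex N ] (Star Step K K′ × IsPoint K′)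

cone-collapsesToPoint : {a : Fin N} {K : Complex N} → Decidable K → IsCone a K → CollapsesToPoint K
cone-collapsesToPoint {a = a} K? cone = go K? cone (<-wellFounded _)
  where
  go : ∀ {K} (K? : Decidable K) → IsCone a K → Acc _<_ (faceCount K?) → CollapsesToPoint K
  go {K} K? cone (acc smaller) with anySubset? (nonemptyBaseFace? K? a)
  ... | no  ∄base = K , ε , cone-isPoint cone (λ F base → ∄base (F , base))
  ... | yes (_ , base)
    with σ , σ-max ← ∃-maximal (nonemptyBaseFace? K? a) base
    with K′ , collapses , point ← go (removePair? K? σ (σ ∪ ⁅ a ⁆)) (removePair-isCone cone σ-max)
                                    (smaller (removePair-fewerFaces cone σ-max K?))
    = K′ , inj₁ (maximal-base-face-collapse cone σ-max) ◅ collapses , point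

liftC? : ∀ p {K : Complex N} → Decidable K → Decidable (liftC p K)
liftC? {N} p {K} K? F with F₀ , F₁ , refl ← splitAt N F =
  map′ (λ (KF₀ , F₁≡∅) → F₀ , KF₀ , cong (F₀ ++_) F₁≡∅)
       (λ (G₀ , KG₀ , eq) → let F₀≡G₀ , F₁≡∅ = ++-injective F₀ G₀ eq in subst K (sym F₀≡G₀) KG₀ , F₁≡∅)
       (K? F₀ ×-dec ≡-dec _≟𝔹_ F₁ ∅)

liftC-isCone : ∀ p {a : Fin N} {K : Complex N} → IsCone a K → IsCone (a ↑ˡ p) (liftC p K)
liftC-isCone {N} p {a} {K} cone = record
  { isComplex = λ { F G G⊆F (F₀ , KF₀ , refl) → lower KF₀ G G⊆F }
  ; ∪-apex    = λ { (F₀ , KF₀ , refl) → F₀ ∪ ⁅ a ⁆ , ∪-apex KF₀ , apex-++ F₀ }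
  ; ∅-face    = ∅ , ∅-face , sym (∅++∅≡∅ N p)
  }
  where
  open IsCone cone
  lower : ∀ {F₀} → K F₀ → ∀ G → G ⊆ F₀ ++ ∅ → liftC p K G
  lower {F₀} KF₀ G G⊆F with G₀ , G₁ , refl ← splitAt N G with G₀⊆F₀ , G₁⊆∅ ← ⊆-++⁻ G₀ F₀ G⊆F =
    G₀ , isComplex F₀ G₀ G₀⊆F₀ KF₀ , cong (G₀ ++_) (⊆-antisym G₁⊆∅ ⊥⊆)
  apex-++ : ∀ F₀ → (F₀ ++ ∅) ∪ ⁅ a ↑ˡ p ⁆ ≡ (F₀ ∪ ⁅ a ⁆) ++ ∅
  apex-++ F₀ = begin
    (F₀ ++ ∅) ∪ ⁅ a ↑ˡ p ⁆     ≡⟨ cong ((F₀ ++ ∅) ∪_) (⁅x↑ˡ⁆≡⁅x⁆++∅ a) ⟩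
    (F₀ ++ ∅) ∪ (⁅ a ⁆ ++ ∅)   ≡⟨ zipWith-++ _ F₀ ∅ ⁅ a ⁆ ∅ ⟩
    (F₀ ∪ ⁅ a ⁆) ++ (∅ ∪ ∅)    ≡⟨ cong ((F₀ ∪ ⁅ a ⁆) ++_) (∪-identityʳ ∅) ⟩
    (F₀ ∪ ⁅ a ⁆) ++ ∅          ∎
    where open ≡-Reasoning

cone-contractible : {a : Fin N} {K : Complex N} → Decidable K → IsCone a K → Contractible K
cone-contractible K? cone = 0 , cone-collapsesToPoint (liftC? 0 K?) (liftC-isCone 0 cone)

-- The complexes Δt k (Kmn m n)

Δt-isComplex : ∀ k (G : Graph N) → IsComplex (Δt k G)
Δt-isComplex k G F F′ F′⊆F (S , S-indep , ∣S∣ , F⊆∁S) = S , S-indep , ∣S∣ , F⊆∁S ∘ F′⊆F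

independent? : {G : Graph N} → (∀ x y → Dec (G x y)) → Decidable (Independent G)
independent? G? S = all? λ x → all? λ y → (x ∈? S) →-dec ((y ∈? S) →-dec ¬? (G? x y))

Δt? : ∀ k {G : Graph N} → (∀ x y → Dec (G x y)) → Decidable (Δt k G)
Δt? k G? F = anySubset? λ S → independent? G? S ×-dec (∣ S ∣ ≟ℕ k) ×-dec (F ⊆? ∁ S)

Δt-facet⇔ : ∀ k (G : Graph N) {F} → IsFacet (Δt k G) F ⇔ (∃[ S ] (Independent G S × ∣ S ∣ ≡ k × F ≡ ∁ S))
Δt-facet⇔ k G = mk⇔ to from
  where
  to : ∀ {F} → IsFacet (Δt k G) F → ∃[ S ] (Independent G S × ∣ S ∣ ≡ k × F ≡ ∁ S)
  to ((S , S-indep , ∣S∣ , F⊆∁S) , maximal) = S , S-indep , ∣S∣ , sym (maximal (∁ S) (S , S-indep , ∣S∣ , id) F⊆∁S)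

  from : ∀ {F} → ∃[ S ] (Independent G S × ∣ S ∣ ≡ k × F ≡ ∁ S) → IsFacet (Δt k G) F
  from (S , S-indep , ∣S∣ , refl) = (S , S-indep , ∣S∣ , id) , maximal
    where
    maximal : ∀ F′ → Δt k G F′ → ∁ S ⊆ F′ → F′ ≡ ∁ S
    maximal F′ (S′ , _ , ∣S′∣ , F′⊆∁S′) ∁S⊆F′ = ⊆-antisym (subst (F′ ⊆_) (cong ∁ S′≡S) F′⊆∁S′) ∁S⊆F′
      where
      S′≡S : S′ ≡ S
      S′≡S = p⊆q∧∣q∣≤∣p∣⇒p≡q (∁p⊆∁q⇒p⊇q (F′⊆∁S′ ∘ ∁S⊆F′)) (≤-reflexive (trans ∣S∣ (sym ∣S′∣)))

Δt-isCone : ∀ k {G : Graph N} {a} → ∃[ S ] (Independent G S × ∣ S ∣ ≡ k) →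
            (∀ {S} → Independent G S → ∣ S ∣ ≡ k → a ∉ S) → IsCone a (Δt k G)
Δt-isCone k {G} (S , S-indep , ∣S∣) a∉ = record
  { isComplex = Δt-isComplex k G
  ; ∪-apex    = λ (S , S-indep , ∣S∣ , F⊆∁S) →
                  S , S-indep , ∣S∣ , ∪-least F⊆∁S (x∈p⇒⁅x⁆⊆p (x∉p⇒x∈∁p (a∉ S-indep ∣S∣)))
  ; ∅-face    = S , S-indep , ∣S∣ , ⊥⊆
  }

Kmn? : ∀ m n x y → Dec (Kmn m n x y)
Kmn? m n x y = ((toℕ x <? m) ×-dec (m ≤? toℕ y)) ⊎-dec ((m ≤? toℕ x) ×-dec (toℕ y <? m))

∅++-independent : ∀ m {n} (s : Subset n) → Independent (Kmn m n) (∅ {m} ++ s)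
∅++-independent m s x y x∈ y∈ (inj₁ (x<m , _)) = <⇒≱ x<m (∈∅++⇒m≤ m x∈)
∅++-independent m s x y x∈ y∈ (inj₂ (_ , y<m)) = <⇒≱ y<m (∈∅++⇒m≤ m y∈)

independent-Kmn : ∀ m {n} {S : Subset (m + n)} → Independent (Kmn m n) S → m < ∣ S ∣ → ∃[ s ] S ≡ ∅ {m} ++ s
independent-Kmn m {n} {S} S-indep m<∣S∣ with p , q , refl ← splitAt m S with nonempty? p
... | no  p-empty   = q , cong (_++ q) (Empty-unique p-empty)
... | yes (i , i∈p) = contradiction m<∣S∣ (≤⇒≯ ∣p++q∣≤m)
  where
  q-empty : Empty q
  q-empty (j , j∈q) = S-indep (i ↑ˡ n) (m ↑ʳ j) (x∈p⇒x↑ˡ∈p++q q i∈p) (x∈q⇒m↑ʳx∈p++q p j∈q)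
    (inj₁ (subst (_< m) (sym (toℕ-↑ˡ i n)) (toℕ<n i) , subst (m ≤_) (sym (toℕ-↑ʳ m j)) (m≤m+n m (toℕ j))))
  ∣p++q∣≤m : ∣ p ++ q ∣ ≤ m
  ∣p++q∣≤m = begin
    ∣ p ++ q ∣      ≡⟨ ∣p++q∣≡∣p∣+∣q∣ p q ⟩
    ∣ p ∣ + ∣ q ∣   ≡⟨ cong (∣ p ∣ +_) (trans (cong ∣_∣ (Empty-unique q-empty)) (∣⊥∣≡0 n)) ⟩
    ∣ p ∣ + 0       ≡⟨ +-identityʳ ∣ p ∣ ⟩
    ∣ p ∣           ≤⟨ ∣p∣≤n p ⟩
    m               ∎
    where open ≤-Reasoning

Δt-Kmn-facet⇔ : ∀ {m k n} {F} → m < k → k ≤ n →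
                IsFacet (Δt k (Kmn m n)) F ⇔ (∃[ T ] (∣ T ∣ ≡ n ∸ k × F ≡ ⊤ {m} ++ T))
Δt-Kmn-facet⇔ {m} {k} {n} m<k k≤n =
  mk⇔ (to ∘ Equivalence.to (Δt-facet⇔ k (Kmn m n))) (Equivalence.from (Δt-facet⇔ k (Kmn m n)) ∘ from)
  where
  to : ∀ {F} → ∃[ S ] (Independent (Kmn m n) S × ∣ S ∣ ≡ k × F ≡ ∁ S) → ∃[ T ] (∣ T ∣ ≡ n ∸ k × F ≡ ⊤ ++ T)
  to (S , S-indep , ∣S∣ , refl) with s , refl ← independent-Kmn m S-indep (subst (m <_) (sym ∣S∣) m<k) =
    ∁ s , trans (∣∁p∣≡n∸∣p∣ s) (cong (n ∸_) (trans (sym (∣∅++p∣≡∣p∣ m s)) ∣S∣)) , ∁[∅++p]≡⊤++∁p m s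

  from : ∀ {F} → ∃[ T ] (∣ T ∣ ≡ n ∸ k × F ≡ ⊤ ++ T) → ∃[ S ] (Independent (Kmn m n) S × ∣ S ∣ ≡ k × F ≡ ∁ S)
  from (T , ∣T∣ , refl) = ∅ ++ ∁ T , ∅++-independent m (∁ T) , ∣∅++∁T∣ , ⊤++T≡∁[∅++∁T]
    where
    ∣∅++∁T∣ : ∣ ∅ {m} ++ ∁ T ∣ ≡ k
    ∣∅++∁T∣ = begin
      ∣ ∅ {m} ++ ∁ T ∣ ≡⟨ ∣∅++p∣≡∣p∣ m (∁ T) ⟩
      ∣ ∁ T ∣          ≡⟨ ∣∁p∣≡n∸∣p∣ T ⟩
      n ∸ ∣ T ∣        ≡⟨ cong (n ∸_) ∣T∣ ⟩
      n ∸ (n ∸ k)      ≡⟨ m∸[m∸n]≡n k≤n ⟩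
      k                ∎
      where open ≡-Reasoning
    ⊤++T≡∁[∅++∁T] : ⊤ ++ T ≡ ∁ (∅ ++ ∁ T)
    ⊤++T≡∁[∅++∁T] = sym (trans (∁[∅++p]≡⊤++∁p m (∁ T)) (cong (⊤ ++_) (∁-involutive T)))

Δt-Kmn-isCone : ∀ {m k n} → suc m < k → k ≤ n → IsCone zero (Δt k (Kmn (suc m) n))
Δt-Kmn-isCone {m} {k} {n} 1+m<k k≤n = Δt-isCone k independent-k-set zero∉
  where
  independent-k-set : ∃[ S ] (Independent (Kmn (suc m) n) S × ∣ S ∣ ≡ k)
  independent-k-set with s , ∣s∣ ← ∃-subsetOfSize {k} {n} k≤n =
    ∅ {suc m} ++ s , ∅++-independent (suc m) s , trans (∣∅++p∣≡∣p∣ (suc m) s) ∣s∣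
  zero∉ : ∀ {S} → Independent (Kmn (suc m) n) S → ∣ S ∣ ≡ k → zero ∉ S
  zero∉ S-indep ∣S∣ with _ , refl ← independent-Kmn (suc m) S-indep (subst (suc m <_) (sym ∣S∣) 1+m<k) = λ ()

proposition4p5 : (m k n : ℕ) → 1 ≤ m → m < k → k < n →
                   Shellable (Δt k (Kmn m n)) × Contractible (Δt k (Kmn m n))
proposition4p5 (suc m) k n _ m<k k<n =
  join-skeleton-shellable (Δt-Kmn-facet⇔ m<k (<⇒≤ k<n)) ,
  cone-contractible (Δt? k (Kmn? (suc m) n)) (Δt-Kmn-isCone m<k (<⇒≤ k<n))
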